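{- For any permutation $w\in S_n$, every monomial appearing (with nonzero coefficient) in the Grothendieck polynomial $\mathfrak{G}_w$ divides $\bm{x}^{\overline{D(w)}}$.
   Context: Notation: $s_j$ is the adjacent transposition; permutations act on the right on positions, so $ws_j$ is $w$ with $w(j),w(j+1)$ swapped. $\partial_j(f)=\frac{f-s_jf}{x_j-x_{j+1}}$ ($s_jf$ swaps $x_j,x_{j+1}$), $\overline{\partial}_j(f)=\partial_j((1-x_{j+1})f)$. Grothendieck polynomials: $\mathfrak{G}_{w_0}=x_1^{n-1}x_2^{n-2}\cdots x_{n-1}$ for $w_0=n\,(n-1)\cdots1$, and $\mathfrak{G}_w=\overline{\partial}_j\mathfrak{G}_{ws_j}$ whenever $w(j)<w(j+1)$. Rothe diagram: $D(w)=\{(i,j)\in[n]^2: i<w^{ -1}(j),\ j<w(i)\}$ (row $i$, column $j$). For a diagram $D\subseteq[n]^2$, its upper closure is $\overline{D}=\{(i,j): i\le i' \text{ for some }(i',j)\in D\}$, and $\bm{x}^D=\prod_{(i,j)\in D}x_i$. -}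

module Defs where

open import Data.Nat as ℕ using (ℕ; zero; suc)
open import Data.Integer as ℤ using (ℤ; 0ℤ; 1ℤ)
open import Data.Fin as Fin using (Fin; toℕ; opposite)
open import Data.Fin.Properties using (any?)
open import Data.Vec as Vec using (Vec; lookup; tabulate; _[_]≔_; zipWith)
open import Data.Vec.Properties using (≡-dec)
open import Data.List as List using (List; []; _∷_; _++_; concatMap; filter; length)
open import Data.Product using (_×_; _,_; ∃; ∃-syntax)
open import Relation.Binary.PropositionalEquality using (_≡_)
open import Relation.Nullary using (Dec; yes; no; _×-dec_)

-- Polynomials in x_1..x_n (variables indexed by Fin n) over ℤ,
-- represented as (unnormalised) lists of terms  c · x^α.

Term : ℕ → Set
Term n = ℤ × Vec ℕ n

Poly : ℕ → Set
Poly n = List (Term n)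

coeff : ∀ {n} → Poly n → Vec ℕ n → ℤ
coeff []             α = 0ℤ
coeff ((c , β) ∷ p) α with ≡-dec ℕ._≟_ β α
... | yes _ = c ℤ.+ coeff p α
... | no  _ = coeff p α

_≈_ : ∀ {n} → Poly n → Poly n → Set
p ≈ q = ∀ α → coeff p α ≡ coeff q α

infix 4 _≈_
infixl 6 _+ₚ_ _-ₚ_
infixl 7 _*ₚ_

_+ₚ_ : ∀ {n} → Poly n → Poly n → Poly n
p +ₚ q = p ++ q

negₚ : ∀ {n} → Poly n → Poly n
negₚ = List.map (λ { (c , α) → (ℤ.- c , α) })

_-ₚ_ : ∀ {n} → Poly n → Poly n → Poly n
p -ₚ q = p +ₚ negₚ q

_*ₚ_ : ∀ {n} → Poly n → Poly n → Poly n
p *ₚ q = concatMap (λ { (c , α) → List.map (λ { (d , β) → (c ℤ.* d , zipWith ℕ._+_ α β) }) q }) p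

mono : ∀ {n} → Vec ℕ n → Poly n
mono α = (1ℤ , α) ∷ []

oneₚ : ∀ {n} → Poly n
oneₚ {n} = mono (Vec.replicate n 0)

var : ∀ {n} → Fin n → Poly n
var {n} i = mono (Vec.replicate n 0 [ i ]≔ 1)

swap : ∀ {a} {A : Set a} {n} → Vec A n → Fin n → Fin n → Vec A n
swap v i k = (v [ i ]≔ lookup v k) [ k ]≔ lookup v i

sₚ : ∀ {n} → Fin n → Fin n → Poly n → Poly n
sₚ j k = List.map (λ { (c , α) → (c , swap α j k) })

-- Permutations in one-line notation:  w = w(1) … w(n)  as a vector.

IsPerm : ∀ {n} → Vec (Fin n) n → Set
IsPerm {n} w = ∀ (i k : Fin n) → lookup w i ≡ lookup w k → i ≡ k

w₀ : ∀ n → Vec (Fin n) n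
w₀ n = tabulate opposite

δ : ∀ n → Vec ℕ n
δ n = tabulate (λ i → n ℕ.∸ suc (toℕ i))

-- Grothendieck polynomials, characterised by their defining recursion:
--   G_{w0} = x^δ,
--   G_w = ∂̄_j G_{w s_j}  whenever w(j) < w(j+1),
-- where ∂̄_j f = ∂_j ((1 - x_{j+1}) f) and ∂_j g is the polynomial h with
-- (x_j - x_{j+1}) h = g - s_j g.  (k below is the index j+1.)

IsGrothendieckFamily : ∀ n → (Vec (Fin n) n → Poly n) → Set
IsGrothendieckFamily n G =
  (G (w₀ n) ≈ mono (δ n)) ×
  (∀ (w : Vec (Fin n) n) → IsPerm w →
   ∀ (j k : Fin n) → toℕ k ≡ suc (toℕ j) →
   lookup w j Fin.< lookup w k →
   let g = (oneₚ -ₚ var k) *ₚ G (swap w j k) in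
   (var j -ₚ var k) *ₚ G w ≈ g -ₚ sₚ j k g)

-- Rothe diagram and its upper closure.
-- (i , j) ∈ D(w)  iff  i < w⁻¹(j)  and  j < w(i);
-- "i < w⁻¹(j)" is written as: the position k with w(k) = j satisfies i < k.

InD : ∀ {n} → Vec (Fin n) n → Fin n → Fin n → Set
InD w i j = (∃[ k ] (lookup w k ≡ j × i Fin.< k)) × (j Fin.< lookup w i)

inD? : ∀ {n} (w : Vec (Fin n) n) i j → Dec (InD w i j)
inD? w i j = any? (λ k → (lookup w k Fin.≟ j) ×-dec (i Fin.<? k)) ×-dec (j Fin.<? lookup w i)

InClosure : ∀ {n} → Vec (Fin n) n → Fin n → Fin n → Set
InClosure w i j = ∃[ i' ] (i Fin.≤ i' × InD w i' j)

inClosure? : ∀ {n} (w : Vec (Fin n) n) i j → Dec (InClosure w i j)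
inClosure? w i j = any? (λ i' → (i Fin.≤? i') ×-dec inD? w i' j)

closureExp : ∀ {n} → Vec (Fin n) n → Vec ℕ n
closureExp {n} w = tabulate (λ i → length (filter (inClosure? w i) (List.allFin n)))

module Submission where

-- Induct along the weak order from w₀, where 𝔊_{w₀} = x^δ and row i of the closure of D(w₀)
-- has n−1−i cells.  At an ascent j of w (chosen with j = 1 or w(j−1) > w(j)) put v = w s_j and
-- g = (1 − x_{j+1}) 𝔊_v, so that (x_j − x_{j+1}) 𝔊_w = g − s_j g.  A bound on exponents that is
-- symmetric in rows j and j+1 passes from g to this product.  Conversely, following a monomial
-- x^α of 𝔊_w in the direction e_j − e_{j+1} until it leaves the support yields a monomial of the
-- product whose j-th exponent exceeds α_j and which dominates α outside row j+1, and symmetrically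
-- with j and j+1 exchanged.  Finally, row j of the closure of D(v) has at most one more cell than
-- row j+1 of that of D(w), and no other row grows.

open import Defs
open import Data.Nat as ℕ using (ℕ; zero; suc; _≤_; _<_; _+_; _∸_; z≤n; s≤s)
import Data.Nat.Properties as ℕₚ
open import Data.Integer as ℤ using (ℤ; 0ℤ; 1ℤ; -1ℤ)
import Data.Integer.Properties as ℤₚ
open import Data.Fin as Fin using (Fin; toℕ; opposite)
import Data.Fin.Properties as Finₚ
open import Data.Fin.Permutation.Components using (transpose; transpose-inverse)
open import Data.Vec as Vec using (Vec; lookup; tabulate; zipWith; replicate; _[_]≔_)
import Data.Vec.Properties as Vecₚ
open import Data.List as List using ([]; _∷_; filter; length)
open import Data.Product using (_×_; _,_; ∃-syntax; Σ-syntax; proj₁; proj₂)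
open import Data.Sum as Sum using (_⊎_; inj₁; inj₂; [_,_]′)
open import Data.Empty using (⊥-elim)
open import Function using (_∘_; id)
open import Relation.Binary.PropositionalEquality
open import Relation.Nullary using (Dec; yes; no; ¬_; contradiction; _×-dec_)
open import Relation.Nullary.Decidable using (dec-true; dec-false)
open import Relation.Unary using (Pred; Decidable)
open import Relation.Binary.Definitions using (DecidableEquality)
open import Level using (0ℓ)
open import Induction.WellFounded using (Acc; acc)
import Data.Nat.Induction as ℕᵢ
import Data.List.Properties as LP
import Data.List.Relation.Unary.All as All
open import Data.List.Relation.Unary.Unique.Propositional using (Unique; []; _∷_)
import Data.List.Relation.Unary.Unique.Propositional.Properties as Uniqueₚ
import Data.List.Relation.Binary.Sublist.Propositional as Sublist
import Data.List.Relation.Binary.Sublist.Propositional.Properties as Sublistₚ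

private
  variable
    n : ℕ

-- Exponent vectors and transpositions

infixl 6 _⊕_

_⊕_ : Vec ℕ n → Vec ℕ n → Vec ℕ n
_⊕_ = zipWith _+_

basis : Fin n → Vec ℕ n
basis {n} i = replicate n 0 [ i ]≔ 1

lookup-ext : ∀ {a} {A : Set a} {xs ys : Vec A n} → (∀ i → lookup xs i ≡ lookup ys i) → xs ≡ ys
lookup-ext {xs = xs} {ys} eq = begin
  xs                  ≡⟨ Vecₚ.tabulate∘lookup xs ⟨
  tabulate (lookup xs) ≡⟨ Vecₚ.tabulate-cong eq ⟩
  tabulate (lookup ys) ≡⟨ Vecₚ.tabulate∘lookup ys ⟩
  ys                  ∎
  where open ≡-Reasoning

lookup-⊕ : ∀ (α β : Vec ℕ n) i → lookup (α ⊕ β) i ≡ lookup α i + lookup β i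
lookup-⊕ α β i = Vecₚ.lookup-zipWith _+_ i α β

⊕-cancelˡ : ∀ (a β β′ : Vec ℕ n) → a ⊕ β ≡ a ⊕ β′ → β ≡ β′
⊕-cancelˡ a β β′ eq = lookup-ext λ i → ℕₚ.+-cancelˡ-≡ (lookup a i) _ _ (begin
  lookup a i + lookup β i  ≡⟨ lookup-⊕ a β i ⟨
  lookup (a ⊕ β) i         ≡⟨ cong (λ γ → lookup γ i) eq ⟩
  lookup (a ⊕ β′) i        ≡⟨ lookup-⊕ a β′ i ⟩
  lookup a i + lookup β′ i ∎)
  where open ≡-Reasoning

lookup-basis-⊕-≡ : ∀ (p : Fin n) α → lookup (basis p ⊕ α) p ≡ suc (lookup α p)
lookup-basis-⊕-≡ {n} p α = trans (lookup-⊕ (basis p) α p) (cong (_+ lookup α p) (Vecₚ.lookup∘update p (replicate n 0) 1))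

lookup-basis-⊕-≢ : ∀ {p i : Fin n} α → i ≢ p → lookup (basis p ⊕ α) i ≡ lookup α i
lookup-basis-⊕-≢ {n} {p} {i} α i≢p = trans (lookup-⊕ (basis p) α i)
  (cong (_+ lookup α i) (trans (Vecₚ.lookup∘update′ i≢p (replicate n 0) 1) (Vecₚ.lookup-replicate i 0)))

lookup-zero-⊕ : ∀ (α : Vec ℕ n) i → lookup (replicate n 0 ⊕ α) i ≡ lookup α i
lookup-zero-⊕ {n} α i = trans (lookup-⊕ (replicate n 0) α i) (cong (_+ lookup α i) (Vecₚ.lookup-replicate i 0))

transpose-matchˡ : ∀ (i j : Fin n) → transpose i j i ≡ j
transpose-matchˡ i j rewrite dec-true (i Fin.≟ i) refl = refl

transpose-matchʳ : ∀ (i j : Fin n) → transpose i j j ≡ i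
transpose-matchʳ i j with j Fin.≟ i
... | yes j≡i = j≡i
... | no _ rewrite dec-true (j Fin.≟ j) refl = refl

transpose-other : ∀ {i j k : Fin n} → k ≢ i → k ≢ j → transpose i j k ≡ k
transpose-other {i = i} {j} {k} k≢i k≢j rewrite dec-false (k Fin.≟ i) k≢i | dec-false (k Fin.≟ j) k≢j = refl

transpose-injective : ∀ (i j : Fin n) {p q} → transpose i j p ≡ transpose i j q → p ≡ q
transpose-injective i j {p} {q} eq = begin
  p                             ≡⟨ transpose-inverse j i ⟨
  transpose j i (transpose i j p) ≡⟨ cong (transpose j i) eq ⟩
  transpose j i (transpose i j q) ≡⟨ transpose-inverse j i ⟩
  q                             ∎
  where open ≡-Reasoning

lookup-swap : ∀ {a} {A : Set a} (v : Vec A n) i k p → lookup (swap v i k) p ≡ lookup v (transpose i k p)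
lookup-swap v i k p = byCases (p Fin.≟ k) (p Fin.≟ i)
  where
  -- a `with` on these tests would also abstract them inside `transpose`, which is defined by them
  open ≡-Reasoning
  byCases : Dec (p ≡ k) → Dec (p ≡ i) → lookup (swap v i k) p ≡ lookup v (transpose i k p)
  byCases (yes refl) _ = trans (Vecₚ.lookup∘update p (v [ i ]≔ lookup v p) (lookup v i)) (cong (lookup v) (sym (transpose-matchʳ i p)))
  byCases (no p≢k) (yes refl) = begin
    lookup (swap v p k) p            ≡⟨ Vecₚ.lookup∘update′ p≢k (v [ p ]≔ lookup v k) (lookup v p) ⟩
    lookup (v [ p ]≔ lookup v k) p   ≡⟨ Vecₚ.lookup∘update p v _ ⟩
    lookup v k                       ≡⟨ cong (lookup v) (transpose-matchˡ p k) ⟨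
    lookup v (transpose p k p)       ∎
  byCases (no p≢k) (no p≢i) = begin
    lookup (swap v i k) p            ≡⟨ Vecₚ.lookup∘update′ p≢k (v [ i ]≔ lookup v k) (lookup v i) ⟩
    lookup (v [ i ]≔ lookup v k) p   ≡⟨ Vecₚ.lookup∘update′ p≢i v _ ⟩
    lookup v p                       ≡⟨ cong (lookup v) (transpose-other p≢i p≢k) ⟨
    lookup v (transpose i k p)       ∎

lookup-swapˡ : ∀ {a} {A : Set a} (v : Vec A n) i k → lookup (swap v i k) i ≡ lookup v k
lookup-swapˡ v i k = trans (lookup-swap v i k i) (cong (lookup v) (transpose-matchˡ i k))

lookup-swapʳ : ∀ {a} {A : Set a} (v : Vec A n) i k → lookup (swap v i k) k ≡ lookup v i
lookup-swapʳ v i k = trans (lookup-swap v i k k) (cong (lookup v) (transpose-matchʳ i k))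

lookup-swap-≢ : ∀ {a} {A : Set a} (v : Vec A n) {i k p} → p ≢ i → p ≢ k → lookup (swap v i k) p ≡ lookup v p
lookup-swap-≢ v {i} {k} {p} p≢i p≢k = trans (lookup-swap v i k p) (cong (lookup v) (transpose-other p≢i p≢k))

swap-involutive : ∀ {a} {A : Set a} (v : Vec A n) i k → swap (swap v i k) i k ≡ v
swap-involutive v i k = lookup-ext λ p → begin
  lookup (swap (swap v i k) i k) p             ≡⟨ lookup-swap (swap v i k) i k p ⟩
  lookup (swap v i k) (transpose i k p)        ≡⟨ lookup-swap v i k _ ⟩
  lookup v (transpose i k (transpose i k p))   ≡⟨ cong (lookup v) (transpose-involutive p) ⟩
  lookup v p                                   ∎
  where
  open ≡-Reasoning
  transpose-involutive : ∀ p → transpose i k (transpose i k p) ≡ p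
  transpose-involutive p = byCases (p Fin.≟ i) (p Fin.≟ k)
    where
    byCases : Dec (p ≡ i) → Dec (p ≡ k) → transpose i k (transpose i k p) ≡ p
    byCases (yes refl) _ = trans (cong (transpose p k) (transpose-matchˡ p k)) (transpose-matchʳ p k)
    byCases (no _) (yes refl) = trans (cong (transpose i p) (transpose-matchʳ i p)) (transpose-matchˡ i p)
    byCases (no p≢i) (no p≢k) = trans (cong (transpose i k) (transpose-other p≢i p≢k)) (transpose-other p≢i p≢k)

IsPerm-swap : ∀ (w : Vec (Fin n) n) → IsPerm w → ∀ i k → IsPerm (swap w i k)
IsPerm-swap w w-inj i k p q eq = transpose-injective i k
  (w-inj _ _ (trans (sym (lookup-swap w i k p)) (trans eq (lookup-swap w i k q))))

-- Coefficients, supports and divided differences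

coeff-+ₚ : ∀ (p q : Poly n) α → coeff (p +ₚ q) α ≡ coeff p α ℤ.+ coeff q α
coeff-+ₚ [] q α = sym (ℤₚ.+-identityˡ _)
coeff-+ₚ ((c , β) ∷ p) q α with Vecₚ.≡-dec ℕ._≟_ β α
... | yes _ = trans (cong (λ x → c ℤ.+ x) (coeff-+ₚ p q α)) (sym (ℤₚ.+-assoc c _ _))
... | no _  = coeff-+ₚ p q α

coeff-negₚ : ∀ (p : Poly n) α → coeff (negₚ p) α ≡ ℤ.- coeff p α
coeff-negₚ [] α = refl
coeff-negₚ ((c , β) ∷ p) α with Vecₚ.≡-dec ℕ._≟_ β α
... | yes _ = trans (cong (λ x → ℤ.- c ℤ.+ x) (coeff-negₚ p α)) (sym (ℤₚ.neg-distrib-+ c _))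
... | no _  = coeff-negₚ p α

coeff-sₚ : ∀ (j k : Fin n) p α → coeff (sₚ j k p) α ≡ coeff p (swap α j k)
coeff-sₚ j k [] α = refl
coeff-sₚ j k ((c , β) ∷ p) α with Vecₚ.≡-dec ℕ._≟_ (swap β j k) α | Vecₚ.≡-dec ℕ._≟_ β (swap α j k)
... | yes _ | yes _ = cong (λ x → c ℤ.+ x) (coeff-sₚ j k p α)
... | no _  | no _  = coeff-sₚ j k p α
... | yes e | no ne = contradiction (trans (sym (swap-involutive β j k)) (cong (λ γ → swap γ j k) e)) ne
... | no ne | yes e = contradiction (trans (cong (λ γ → swap γ j k) e) (swap-involutive α j k)) ne

termMul : ℤ → Vec ℕ n → Poly n → Poly n
termMul c a = List.map λ { (d , β) → (c ℤ.* d , a ⊕ β) }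

coeff-termMul-⊕ : ∀ c (a : Vec ℕ n) h β → coeff (termMul c a h) (a ⊕ β) ≡ c ℤ.* coeff h β
coeff-termMul-⊕ c a [] β = sym (ℤₚ.*-zeroʳ c)
coeff-termMul-⊕ c a ((d , β′) ∷ h) β with Vecₚ.≡-dec ℕ._≟_ (a ⊕ β′) (a ⊕ β) | Vecₚ.≡-dec ℕ._≟_ β′ β
... | yes _  | yes _  = trans (cong (λ x → c ℤ.* d ℤ.+ x) (coeff-termMul-⊕ c a h β)) (sym (ℤₚ.*-distribˡ-+ c d _))
... | no _   | no _   = coeff-termMul-⊕ c a h β
... | yes e  | no ne  = contradiction (⊕-cancelˡ a β′ β e) ne
... | no ne  | yes e  = contradiction (cong (a ⊕_) e) ne

termMul-shifted : ∀ c (a : Vec ℕ n) h γ → coeff (termMul c a h) γ ≢ 0ℤ → ∃[ β ] (γ ≡ a ⊕ β)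
termMul-shifted c a [] γ γ∈ = contradiction refl γ∈
termMul-shifted c a ((_ , β) ∷ h) γ γ∈ with Vecₚ.≡-dec ℕ._≟_ (a ⊕ β) γ
... | yes a⊕β≡γ = β , sym a⊕β≡γ
... | no _      = termMul-shifted c a h γ γ∈

termMul-support : ∀ c (a : Vec ℕ n) h γ → coeff (termMul c a h) γ ≢ 0ℤ →
  ∃[ β ] (γ ≡ a ⊕ β × coeff h β ≢ 0ℤ)
termMul-support c a h γ γ∈ with termMul-shifted c a h γ γ∈
... | β , refl = β , refl , λ h[β]≡0 → γ∈ (begin
  coeff (termMul c a h) (a ⊕ β)  ≡⟨ coeff-termMul-⊕ c a h β ⟩
  c ℤ.* coeff h β                ≡⟨ cong (c ℤ.*_) h[β]≡0 ⟩
  c ℤ.* 0ℤ                       ≡⟨ ℤₚ.*-zeroʳ c ⟩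
  0ℤ                             ∎)
  where open ≡-Reasoning

coeff-binomial-*ₚ : ∀ c (a : Vec ℕ n) d b h γ →
  coeff (((c , a) ∷ (d , b) ∷ []) *ₚ h) γ ≡ coeff (termMul c a h) γ ℤ.+ coeff (termMul d b h) γ
coeff-binomial-*ₚ c a d b h γ = begin
  coeff (termMul c a h List.++ (termMul d b h List.++ [])) γ   ≡⟨ coeff-+ₚ (termMul c a h) _ γ ⟩
  coeff (termMul c a h) γ ℤ.+ coeff (termMul d b h List.++ []) γ ≡⟨ cong (λ x → coeff (termMul c a h) γ ℤ.+ x) (coeff-+ₚ (termMul d b h) [] γ) ⟩
  coeff (termMul c a h) γ ℤ.+ (coeff (termMul d b h) γ ℤ.+ 0ℤ)  ≡⟨ cong (λ x → coeff (termMul c a h) γ ℤ.+ x) (ℤₚ.+-identityʳ _) ⟩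
  coeff (termMul c a h) γ ℤ.+ coeff (termMul d b h) γ ∎
  where open ≡-Reasoning

mono-support : ∀ (β α : Vec ℕ n) → coeff (mono β) α ≢ 0ℤ → β ≡ α
mono-support β α β∈ with Vecₚ.≡-dec ℕ._≟_ β α
... | yes β≡α = β≡α
... | no _    = contradiction refl β∈

Supported : (Vec ℕ n → Set) → Poly n → Set
Supported P p = ∀ α → coeff p α ≢ 0ℤ → P α

BoundedBy : Vec ℕ n → Poly n → Set
BoundedBy c = Supported λ α → ∀ i → lookup α i ≤ lookup c i

i+j≢0⇒i≢0⊎j≢0 : ∀ a b → a ℤ.+ b ≢ 0ℤ → a ≢ 0ℤ ⊎ b ≢ 0ℤ
i+j≢0⇒i≢0⊎j≢0 a b a+b≢0 with a ℤₚ.≟ 0ℤ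
... | no a≢0   = inj₁ a≢0
... | yes refl = inj₂ λ b≡0 → a+b≢0 (trans (ℤₚ.+-identityˡ b) b≡0)

Supported-−sₚ : ∀ (j k : Fin n) {P} g → Supported P g → (∀ α → P (swap α j k) → P α) →
  Supported P (g -ₚ sₚ j k g)
Supported-−sₚ j k g g⊆P P-swap α α∈ with coeff g α ℤₚ.≟ 0ℤ
... | no g[α]≢0  = g⊆P α g[α]≢0
... | yes g[α]≡0 = P-swap α (g⊆P (swap α j k) λ g[sα]≡0 → α∈ (begin
  coeff (g -ₚ sₚ j k g) α                       ≡⟨ coeff-+ₚ g _ α ⟩
  coeff g α ℤ.+ coeff (negₚ (sₚ j k g)) α        ≡⟨ cong₂ ℤ._+_ g[α]≡0 (coeff-negₚ (sₚ j k g) α) ⟩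
  0ℤ ℤ.+ ℤ.- coeff (sₚ j k g) α                 ≡⟨ cong (λ x → 0ℤ ℤ.+ ℤ.- x) (trans (coeff-sₚ j k g α) g[sα]≡0) ⟩
  0ℤ                                            ∎))
  where open ≡-Reasoning

Supported-oneMinusVar-*ₚ : ∀ (k : Fin n) c G → BoundedBy c G →
  Supported (λ γ → (∀ i → i ≢ k → lookup γ i ≤ lookup c i) × lookup γ k ≤ suc (lookup c k))
            ((oneₚ -ₚ var k) *ₚ G)
Supported-oneMinusVar-*ₚ {n} k c G G≤c γ γ∈
  with i+j≢0⇒i≢0⊎j≢0 _ _ (λ z → γ∈ (trans (coeff-binomial-*ₚ 1ℤ (replicate n 0) -1ℤ (basis k) G γ) z))
... | inj₁ γ∈1G with termMul-support 1ℤ (replicate n 0) G γ γ∈1G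
...   | β , refl , β∈G = (λ i _ → bound i) , ℕₚ.m≤n⇒m≤1+n (bound k)
  where
  bound : ∀ i → lookup (replicate n 0 ⊕ β) i ≤ lookup c i
  bound i = subst (_≤ lookup c i) (sym (lookup-zero-⊕ β i)) (G≤c β β∈G i)
Supported-oneMinusVar-*ₚ {n} k c G G≤c γ γ∈ | inj₂ γ∈xG with termMul-support -1ℤ (basis k) G γ γ∈xG
...   | β , refl , β∈G =
  (λ i i≢k → subst (_≤ lookup c i) (sym (lookup-basis-⊕-≢ β i≢k)) (G≤c β β∈G i)) ,
  subst (_≤ suc (lookup c k)) (sym (lookup-basis-⊕-≡ k β)) (s≤s (G≤c β β∈G k))

OnlyCancelledBy : Poly n → Poly n → Vec ℕ n → Vec ℕ n → Set
OnlyCancelledBy Q h a b = ∀ α → coeff h α ≢ 0ℤ →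
  coeff Q (a ⊕ α) ≢ 0ℤ ⊎ ∃[ α′ ] (a ⊕ α ≡ b ⊕ α′ × coeff h α′ ≢ 0ℤ)

OnlyCancelledBy-binomial : ∀ (Q h : Poly n) c d (a b : Vec ℕ n) → c ≢ 0ℤ →
  (∀ γ → coeff Q γ ≡ coeff (termMul c a h) γ ℤ.+ coeff (termMul d b h) γ) →
  OnlyCancelledBy Q h a b
OnlyCancelledBy-binomial Q h c d a b c≢0 coeff-Q α α∈h
  with coeff (termMul d b h) (a ⊕ α) ℤₚ.≟ 0ℤ
... | no bh≢0 = inj₂ (termMul-support d b h (a ⊕ α) bh≢0)
... | yes bh≡0 = inj₁ λ Q≡0 → [ c≢0 , α∈h ]′ (ℤₚ.i*j≡0⇒i≡0∨j≡0 c (begin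
  c ℤ.* coeff h α                                                 ≡⟨ coeff-termMul-⊕ c a h α ⟨
  coeff (termMul c a h) (a ⊕ α)                                   ≡⟨ ℤₚ.+-identityʳ _ ⟨
  coeff (termMul c a h) (a ⊕ α) ℤ.+ 0ℤ                            ≡⟨ cong (λ x → coeff (termMul c a h) (a ⊕ α) ℤ.+ x) bh≡0 ⟨
  coeff (termMul c a h) (a ⊕ α) ℤ.+ coeff (termMul d b h) (a ⊕ α) ≡⟨ coeff-Q (a ⊕ α) ⟨
  coeff Q (a ⊕ α)                                                 ≡⟨ Q≡0 ⟩
  0ℤ                                                              ∎))
  where open ≡-Reasoning

Exceeds : Fin n → Fin n → Vec ℕ n → Vec ℕ n → Set
Exceeds p q α β = suc (lookup α p) ≤ lookup β p × (∀ i → i ≢ q → lookup α i ≤ lookup β i)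

Exceeds-basis-⊕ : ∀ {p q : Fin n} α → Exceeds p q α (basis p ⊕ α)
Exceeds-basis-⊕ {p = p} α = ℕₚ.≤-reflexive (sym (lookup-basis-⊕-≡ p α)) , λ i _ → begin
  lookup α i                            ≤⟨ ℕₚ.m≤n+m (lookup α i) (lookup (basis p) i) ⟩
  lookup (basis p) i + lookup α i       ≡⟨ lookup-⊕ (basis p) α i ⟨
  lookup (basis p ⊕ α) i                ∎
  where open ℕₚ.≤-Reasoning

Exceeds-trans : ∀ {p q : Fin n} {α α′ β} → Exceeds p q α α′ → Exceeds p q α′ β → Exceeds p q α β
Exceeds-trans (α<α′ , α≤α′) (α′<β , α′≤β) =
  ℕₚ.≤-trans α<α′ (ℕₚ.<⇒≤ α′<β) , λ i i≢q → ℕₚ.≤-trans (α≤α′ i i≢q) (α′≤β i i≢q)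

basis-exchange : ∀ {p q : Fin n} {α α′} → p ≢ q → basis p ⊕ α ≡ basis q ⊕ α′ →
  Exceeds p q α α′ × lookup α q ≡ suc (lookup α′ q)
basis-exchange {p = p} {q} {α} {α′} p≢q eq = (ℕₚ.≤-reflexive at-p , off-q) , at-q
  where
  open ≡-Reasoning
  at : ∀ i → lookup (basis p ⊕ α) i ≡ lookup (basis q ⊕ α′) i
  at i = cong (λ γ → lookup γ i) eq
  at-p : suc (lookup α p) ≡ lookup α′ p
  at-p = trans (sym (lookup-basis-⊕-≡ p α)) (trans (at p) (lookup-basis-⊕-≢ α′ p≢q))
  at-q : lookup α q ≡ suc (lookup α′ q)
  at-q = trans (sym (lookup-basis-⊕-≢ α (p≢q ∘ sym))) (trans (at q) (lookup-basis-⊕-≡ q α′))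
  off-q : ∀ i → i ≢ q → lookup α i ≤ lookup α′ i
  off-q i i≢q with i Fin.≟ p
  ... | yes refl = ℕₚ.<⇒≤ (ℕₚ.≤-reflexive at-p)
  ... | no i≢p = ℕₚ.≤-reflexive (trans (sym (lookup-basis-⊕-≢ α i≢p)) (trans (at i) (lookup-basis-⊕-≢ α′ i≢q)))

exceedingMonomial : ∀ {p q : Fin n} (Q h : Poly n) → p ≢ q → OnlyCancelledBy Q h (basis p) (basis q) →
  ∀ α → coeff h α ≢ 0ℤ → ∃[ β ] (coeff Q β ≢ 0ℤ × Exceeds p q α β)
exceedingMonomial {p = p} {q} Q h p≢q step α α∈h = walk (lookup α q) α refl α∈h
  where
  walk : ∀ m α → lookup α q ≡ m → coeff h α ≢ 0ℤ → ∃[ β ] (coeff Q β ≢ 0ℤ × Exceeds p q α β)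
  walk m α αq≡m α∈h with step α α∈h
  ... | inj₁ β∈Q = _ , β∈Q , Exceeds-basis-⊕ α
  ... | inj₂ (α′ , eq , α′∈h) with basis-exchange p≢q eq | m
  ...   | _ , αq≡1+α′q | zero = contradiction (trans (sym αq≡1+α′q) αq≡m) ℕₚ.1+n≢0
  ...   | α<α′ , αq≡1+α′q | suc m with walk m α′ (ℕₚ.suc-injective (trans (sym αq≡1+α′q) αq≡m)) α′∈h
  ...     | β , β∈Q , α′<β = β , β∈Q , Exceeds-trans {p = p} {q} {α} {α′} {β} α<α′ α′<β

varDiff-*ₚ-exceeding : ∀ {j k : Fin n} → j ≢ k → ∀ h α → coeff h α ≢ 0ℤ →
  (∃[ β ] (coeff ((var j -ₚ var k) *ₚ h) β ≢ 0ℤ × Exceeds j k α β)) ×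
  (∃[ β ] (coeff ((var j -ₚ var k) *ₚ h) β ≢ 0ℤ × Exceeds k j α β))
-- var j -ₚ var k reduces to the two-term list ((1ℤ , basis j) ∷ (-1ℤ , basis k) ∷ []).
varDiff-*ₚ-exceeding {j = j} {k} j≢k h α α∈h =
  exceedingMonomial Q h j≢k (OnlyCancelledBy-binomial Q h 1ℤ -1ℤ (basis j) (basis k) (λ ()) coeff-Q) α α∈h ,
  exceedingMonomial Q h (j≢k ∘ sym) (OnlyCancelledBy-binomial Q h -1ℤ 1ℤ (basis k) (basis j) (λ ())
    λ γ → trans (coeff-Q γ) (ℤₚ.+-comm (coeff (termMul 1ℤ (basis j) h) γ) _)) α α∈h
  where
  Q : Poly _
  Q = (var j -ₚ var k) *ₚ h
  coeff-Q : ∀ γ → coeff Q γ ≡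
                  coeff (termMul 1ℤ (basis j) h) γ ℤ.+ coeff (termMul -1ℤ (basis k) h) γ
  coeff-Q = coeff-binomial-*ₚ 1ℤ (basis j) -1ℤ (basis k) h

divided-difference-bound : ∀ {j k : Fin n} → j ≢ k → ∀ (f h : Poly n) (c : Vec ℕ n) T →
  (let g = (oneₚ -ₚ var k) *ₚ f in (var j -ₚ var k) *ₚ h ≈ g -ₚ sₚ j k g) →
  BoundedBy c f → lookup c j ≤ T → suc (lookup c k) ≤ T →
  ∀ α → coeff h α ≢ 0ℤ →
  (∀ i → i ≢ j → i ≢ k → lookup α i ≤ lookup c i) × lookup α j < T × lookup α k < T
divided-difference-bound {j = j} {k} j≢k f h c T h-rec f≤c c[j]≤T c[k]<T α α∈h
  with varDiff-*ₚ-exceeding j≢k h α α∈h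
... | (β₁ , β₁∈ , α[j]<β₁[j] , α≤β₁) , (β₂ , β₂∈ , α[k]<β₂[k] , _) =
  (λ i i≢j i≢k → ℕₚ.≤-trans (α≤β₁ i i≢k) (proj₁ (Q⊆P β₁ β₁∈) i i≢j i≢k)) ,
  ℕₚ.<-≤-trans α[j]<β₁[j] (proj₁ (proj₂ (Q⊆P β₁ β₁∈))) ,
  ℕₚ.<-≤-trans α[k]<β₂[k] (proj₂ (proj₂ (Q⊆P β₂ β₂∈)))
  where
  P : Vec ℕ _ → Set
  P γ = (∀ i → i ≢ j → i ≢ k → lookup γ i ≤ lookup c i) × lookup γ j ≤ T × lookup γ k ≤ T
  g : Poly _
  g = (oneₚ -ₚ var k) *ₚ f
  g⊆P : Supported P g
  g⊆P γ γ∈g with Supported-oneMinusVar-*ₚ k c f f≤c γ γ∈g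
  ... | γ≤c , γ[k]≤1+c[k] = (λ i _ i≢k → γ≤c i i≢k) , ℕₚ.≤-trans (γ≤c j j≢k) c[j]≤T , ℕₚ.≤-trans γ[k]≤1+c[k] c[k]<T
  P-swap : ∀ γ → P (swap γ j k) → P γ
  P-swap γ (sγ≤c , sγ[j]≤T , sγ[k]≤T) =
    (λ i i≢j i≢k → subst (_≤ lookup c i) (lookup-swap-≢ γ i≢j i≢k) (sγ≤c i i≢j i≢k)) ,
    subst (_≤ T) (lookup-swapʳ γ j k) sγ[k]≤T ,
    subst (_≤ T) (lookup-swapˡ γ j k) sγ[j]≤T
  Q⊆P : Supported P ((var j -ₚ var k) *ₚ h)
  Q⊆P γ γ∈Q = Supported-−sₚ j k g g⊆P P-swap γ (γ∈Q ∘ trans (h-rec γ))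

-- Permutations, ascents and w₀

-- positionSum w = Σₚ p · w(p), which drops whenever an ascent is sorted.
positionSum : ∀ {m} → Vec (Fin n) m → ℕ
positionSum Vec.[]       = 0
positionSum (_ Vec.∷ xs) = Vec.sum (Vec.map toℕ xs) + positionSum xs

sum-swap-adjacent : ∀ {m} (xs : Vec (Fin n) m) (j k : Fin m) → toℕ k ≡ suc (toℕ j) →
  Vec.sum (Vec.map toℕ (swap xs j k)) ≡ Vec.sum (Vec.map toℕ xs)
sum-swap-adjacent (a Vec.∷ b Vec.∷ ys) Fin.zero (Fin.suc Fin.zero) _ = begin
  toℕ b + (toℕ a + s) ≡⟨ ℕₚ.+-assoc (toℕ b) (toℕ a) s ⟨
  toℕ b + toℕ a + s   ≡⟨ cong (_+ s) (ℕₚ.+-comm (toℕ b) (toℕ a)) ⟩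
  toℕ a + toℕ b + s   ≡⟨ ℕₚ.+-assoc (toℕ a) (toℕ b) s ⟩
  toℕ a + (toℕ b + s) ∎
  where
  open ≡-Reasoning
  s : ℕ
  s = Vec.sum (Vec.map toℕ ys)
sum-swap-adjacent (a Vec.∷ ys) (Fin.suc j) (Fin.suc k) k≡1+j =
  cong (toℕ a +_) (sum-swap-adjacent ys j k (ℕₚ.suc-injective k≡1+j))

positionSum-swap-ascent : ∀ {m} (xs : Vec (Fin n) m) (j k : Fin m) → toℕ k ≡ suc (toℕ j) →
  lookup xs j Fin.< lookup xs k → positionSum (swap xs j k) < positionSum xs
positionSum-swap-ascent (a Vec.∷ b Vec.∷ ys) Fin.zero (Fin.suc Fin.zero) _ a<b =
  ℕₚ.+-monoˡ-< (positionSum (b Vec.∷ ys)) (ℕₚ.+-monoˡ-< (Vec.sum (Vec.map toℕ ys)) a<b)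
positionSum-swap-ascent (a Vec.∷ ys) (Fin.suc j) (Fin.suc k) k≡1+j asc =
  subst (λ s → s + positionSum (swap ys j k) < _) (sym (sum-swap-adjacent ys j k (ℕₚ.suc-injective k≡1+j)))
    (ℕₚ.+-monoʳ-< _ (positionSum-swap-ascent ys j k (ℕₚ.suc-injective k≡1+j) asc))

pred-position : ∀ {i j : Fin n} → i Fin.< j → Σ[ h ∈ Fin n ] (toℕ j ≡ suc (toℕ h) × i Fin.≤ h)
pred-position {suc n} {j = Fin.suc j} (s≤s i≤j) =
  Fin.inject₁ j , cong suc (sym (Finₚ.toℕ-inject₁ {n = n} j)) , subst (_ ≤_) (sym (Finₚ.toℕ-inject₁ {n = n} j)) i≤j

predecessor : ∀ {j : Fin n} {m} → toℕ j ≡ suc m → Σ[ h ∈ Fin n ] (toℕ h ≡ m)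
predecessor {suc n} {Fin.suc j} 1+j≡1+m = Fin.inject₁ j , trans (Finₚ.toℕ-inject₁ {n = n} j) (ℕₚ.suc-injective 1+j≡1+m)

module _ (w : Vec (Fin n) n) (decreasing : ∀ j k → toℕ k ≡ suc (toℕ j) → lookup w k Fin.< lookup w j) where

  private
    bounded-above : ∀ m i → toℕ i ≡ m → toℕ (lookup w i) + m < n
    bounded-above zero i _ = subst (_< n) (sym (ℕₚ.+-identityʳ _)) (Finₚ.toℕ<n (lookup w i))
    bounded-above (suc m) i i≡1+m with predecessor i≡1+m
    ... | h , h≡m = begin-strict
      toℕ (lookup w i) + suc m  ≡⟨ ℕₚ.+-suc _ m ⟩
      suc (toℕ (lookup w i) + m) ≤⟨ ℕₚ.+-monoˡ-≤ m (decreasing h i (trans i≡1+m (cong suc (sym h≡m)))) ⟩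
      toℕ (lookup w h) + m      <⟨ bounded-above m h h≡m ⟩
      n                         ∎
      where open ℕₚ.≤-Reasoning

    bounded-below : ∀ d i → toℕ i + suc d ≡ n → d ≤ toℕ (lookup w i)
    bounded-below zero _ _ = z≤n
    bounded-below (suc d) i i+2+d≡n = ℕₚ.≤-trans (s≤s (bounded-below d k k+1+d≡n)) (decreasing i k k≡1+i)
      where
      n≡2+i+d : n ≡ suc (suc (toℕ i + d))
      n≡2+i+d = trans (sym i+2+d≡n) (trans (ℕₚ.+-suc (toℕ i) (suc d)) (cong suc (ℕₚ.+-suc (toℕ i) d)))
      1+i<n : suc (toℕ i) < n
      1+i<n = subst (suc (toℕ i) <_) (sym n≡2+i+d) (s≤s (s≤s (ℕₚ.m≤m+n (toℕ i) d)))
      k : Fin n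
      k = Fin.fromℕ< 1+i<n
      k≡1+i : toℕ k ≡ suc (toℕ i)
      k≡1+i = Finₚ.toℕ-fromℕ< 1+i<n
      k+1+d≡n : toℕ k + suc d ≡ n
      k+1+d≡n = trans (cong (_+ suc d) k≡1+i) (trans (sym (ℕₚ.+-suc (toℕ i) (suc d))) i+2+d≡n)

  strictlyDecreasing⇒≡w₀ : w ≡ w₀ n
  strictlyDecreasing⇒≡w₀ = lookup-ext λ i → Finₚ.toℕ-injective (begin
    toℕ (lookup w i)          ≡⟨ ℕₚ.≤-antisym (upper i) (lower i) ⟩
    n ∸ suc (toℕ i)           ≡⟨ Finₚ.opposite-prop i ⟨
    toℕ (opposite i)          ≡⟨ cong toℕ (Vecₚ.lookup∘tabulate opposite i) ⟨
    toℕ (lookup (w₀ n) i)     ∎)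
    where
    open ≡-Reasoning
    upper : ∀ i → toℕ (lookup w i) ≤ n ∸ suc (toℕ i)
    upper i = ℕₚ.m+n≤o⇒m≤o∸n (toℕ (lookup w i))
      (subst (_≤ n) (sym (ℕₚ.+-suc _ (toℕ i))) (bounded-above (toℕ i) i refl))
    lower : ∀ i → n ∸ suc (toℕ i) ≤ toℕ (lookup w i)
    lower i = bounded-below (n ∸ suc (toℕ i)) i
      (trans (ℕₚ.+-suc (toℕ i) _) (ℕₚ.m+[n∸m]≡n (Finₚ.toℕ<n i)))

AscentAt : Vec (Fin n) n → Fin n → Fin n → Set
AscentAt w j k = toℕ k ≡ suc (toℕ j) × lookup w j Fin.< lookup w k

ascent? : ∀ (w : Vec (Fin n) n) → Dec (∃[ j ] ∃[ k ] AscentAt w j k)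
ascent? w = Finₚ.any? λ j → Finₚ.any? λ k → (toℕ k ℕ.≟ suc (toℕ j)) ×-dec (lookup w j Fin.<? lookup w k)

adjacent-≢ : ∀ {j k : Fin n} → toℕ k ≡ suc (toℕ j) → j ≢ k
adjacent-≢ k≡1+j j≡k = ℕₚ.1+n≢n (sym (trans (cong toℕ j≡k) k≡1+j))

noAscent⇒≡w₀ : ∀ (w : Vec (Fin n) n) → IsPerm w → ¬ (∃[ j ] ∃[ k ] AscentAt w j k) → w ≡ w₀ n
noAscent⇒≡w₀ w w-inj no-ascent = strictlyDecreasing⇒≡w₀ w λ j k k≡1+j →
  Finₚ.≤∧≢⇒< (ℕₚ.≮⇒≥ λ w[j]<w[k] → no-ascent (j , k , k≡1+j , w[j]<w[k]))
             (adjacent-≢ k≡1+j ∘ sym ∘ w-inj k j)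

DescentBefore : Vec (Fin n) n → Fin n → Set
DescentBefore w j = ∀ h → toℕ j ≡ suc (toℕ h) → lookup w j Fin.< lookup w h

ascent-after-descent : ∀ (w : Vec (Fin n) n) → IsPerm w → ∀ {j k} → AscentAt w j k →
  ∃[ j′ ] ∃[ k′ ] (AscentAt w j′ k′ × DescentBefore w j′)
ascent-after-descent w w-inj {j} {k} asc = go (toℕ j) j k refl asc
  where
  go : ∀ m j k → toℕ j ≡ m → AscentAt w j k → ∃[ j′ ] ∃[ k′ ] (AscentAt w j′ k′ × DescentBefore w j′)
  go zero j k j≡0 asc = j , k , asc , λ h j≡1+h → contradiction (trans (sym j≡0) j≡1+h) ℕₚ.0≢1+n
  go (suc m) j k j≡1+m asc with predecessor j≡1+m
  ... | h , h≡m with lookup w j Fin.<? lookup w h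
  ...   | yes w[j]<w[h] = j , k , asc , λ h′ j≡1+h′ →
          subst (λ x → lookup w j Fin.< lookup w x) (Finₚ.toℕ-injective (trans h≡m (ℕₚ.suc-injective (trans (sym j≡1+m) j≡1+h′)))) w[j]<w[h]
  ...   | no w[j]≮w[h] = go m h j h≡m (j≡1+h , Finₚ.≤∧≢⇒< (ℕₚ.≮⇒≥ w[j]≮w[h]) (adjacent-≢ j≡1+h ∘ w-inj h j))
    where
    j≡1+h : toℕ j ≡ suc (toℕ h)
    j≡1+h = trans j≡1+m (cong suc (sym h≡m))

-- Counting cells of the upper closure

length-filter-∷-≥ : ∀ {A : Set} {P : Pred A 0ℓ} (P? : Decidable P) x xs →
  length (filter P? xs) ≤ length (filter P? (x ∷ xs))
length-filter-∷-≥ P? x xs with P? x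
... | yes _ = ℕₚ.n≤1+n _
... | no _  = ℕₚ.≤-refl

length-filter-∪ : ∀ {A : Set} {P Q R : Pred A 0ℓ} (P? : Decidable P) (Q? : Decidable Q) (R? : Decidable R) →
  (∀ {x} → P x → Q x ⊎ R x) → ∀ xs →
  length (filter P? xs) ≤ length (filter Q? xs) + length (filter R? xs)
length-filter-∪ P? Q? R? P⊆Q∪R [] = z≤n
length-filter-∪ P? Q? R? P⊆Q∪R (x ∷ xs) with ih ← length-filter-∪ P? Q? R? P⊆Q∪R xs | P? x
... | no _ = ℕₚ.≤-trans ih (ℕₚ.+-mono-≤ (length-filter-∷-≥ Q? x xs) (length-filter-∷-≥ R? x xs))
... | yes px with Q? x
...   | yes _ = s≤s (ℕₚ.≤-trans ih (ℕₚ.+-monoʳ-≤ _ (length-filter-∷-≥ R? x xs)))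
...   | no ¬qx with R? x
...     | yes _  = ℕₚ.≤-trans (s≤s ih) (ℕₚ.≤-reflexive (sym (ℕₚ.+-suc _ _)))
...     | no ¬rx = ⊥-elim ([ ¬qx , ¬rx ]′ (P⊆Q∪R px))

length-filter-≡-≤1 : ∀ {A : Set} (_≟_ : DecidableEquality A) a {xs} → Unique xs →
  length (filter (_≟ a) xs) ≤ 1
length-filter-≡-≤1 _≟_ a [] = z≤n
length-filter-≡-≤1 _≟_ a {x ∷ xs} (x∉xs ∷ xs-unique) with x ≟ a
... | yes refl = s≤s (ℕₚ.≤-reflexive (cong length (LP.filter-none (_≟ x) (All.map (_∘ sym) x∉xs))))
... | no _     = length-filter-≡-≤1 _≟_ a xs-unique

length-filter-tabulate-≥ : ∀ {A : Set} {P : Pred A 0ℓ} (P? : Decidable P) {m} (f : Fin m → A) t → t ≤ m →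
  (∀ i → toℕ i < t → P (f i)) → t ≤ length (filter P? (List.tabulate f))
length-filter-tabulate-≥ P? f zero _ _ = z≤n
length-filter-tabulate-≥ P? {suc m} f (suc t) (s≤s t≤m) P-prefix with P? (f Fin.zero)
... | yes _   = s≤s (length-filter-tabulate-≥ P? (f ∘ Fin.suc) t t≤m λ i i<t → P-prefix (Fin.suc i) (s≤s i<t))
... | no ¬p₀ = contradiction (P-prefix Fin.zero (s≤s z≤n)) ¬p₀

lookup-closureExp : ∀ (w : Vec (Fin n) n) i →
  lookup (closureExp w) i ≡ length (filter (inClosure? w i) (List.allFin n))
lookup-closureExp {n} w = Vecₚ.lookup∘tabulate λ i → length (filter (inClosure? w i) (List.allFin n))

closureExp-mono : ∀ (v w : Vec (Fin n) n) i i′ → (∀ {c} → InClosure v i c → InClosure w i′ c) →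
  lookup (closureExp v) i ≤ lookup (closureExp w) i′
closureExp-mono {n} v w i i′ v⊆w = begin
  lookup (closureExp v) i                                ≡⟨ lookup-closureExp v i ⟩
  length (filter (inClosure? v i) (List.allFin n))       ≤⟨ Sublistₚ.length-mono-≤ (Sublistₚ.filter⁺ (inClosure? v i) (inClosure? w i′) (λ { refl → v⊆w }) (Sublist.⊆-refl {x = List.allFin n})) ⟩
  length (filter (inClosure? w i′) (List.allFin n))      ≡⟨ lookup-closureExp w i′ ⟨
  lookup (closureExp w) i′                               ∎
  where open ℕₚ.≤-Reasoning

closureExp-mono-insert : ∀ (v w : Vec (Fin n) n) i i′ a → (∀ {c} → InClosure v i c → InClosure w i′ c ⊎ c ≡ a) →
  lookup (closureExp v) i ≤ suc (lookup (closureExp w) i′)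
closureExp-mono-insert {n} v w i i′ a v⊆w∪a = begin
  lookup (closureExp v) i                                ≡⟨ lookup-closureExp v i ⟩
  length (filter (inClosure? v i) (List.allFin n))       ≤⟨ length-filter-∪ (inClosure? v i) (inClosure? w i′) (Fin._≟ a) v⊆w∪a (List.allFin n) ⟩
  length (filter (inClosure? w i′) (List.allFin n)) + length (filter (Fin._≟ a) (List.allFin n))
                                                         ≤⟨ ℕₚ.+-monoʳ-≤ _ (length-filter-≡-≤1 Fin._≟_ a (Uniqueₚ.allFin⁺ n)) ⟩
  length (filter (inClosure? w i′) (List.allFin n)) + 1  ≡⟨ ℕₚ.+-comm _ 1 ⟩
  suc (length (filter (inClosure? w i′) (List.allFin n))) ≡⟨ cong suc (lookup-closureExp w i′) ⟨
  suc (lookup (closureExp w) i′)                         ∎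
  where open ℕₚ.≤-Reasoning

closureExp-antitone : ∀ (w : Vec (Fin n) n) {i i′} → i Fin.≤ i′ →
  lookup (closureExp w) i′ ≤ lookup (closureExp w) i
closureExp-antitone w i≤i′ = closureExp-mono w w _ _ λ (i″ , i′≤i″ , d) → i″ , ℕₚ.≤-trans i≤i′ i′≤i″ , d

module AscentSwap (w : Vec (Fin n) n) (j k : Fin n) (k≡1+j : toℕ k ≡ suc (toℕ j))
  (ascent : lookup w j Fin.< lookup w k) (descent : DescentBefore w j) where

  v : Vec (Fin n) n
  v = swap w j k

  j<k : j Fin.< k
  j<k = ℕₚ.≤-reflexive (sym k≡1+j)

  j≢k : j ≢ k
  j≢k = Finₚ.<⇒≢ j<k

  right-of-j : ∀ {p} → j Fin.< p → p ≢ k → k Fin.< p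
  right-of-j j<p p≢k = Finₚ.≤∧≢⇒< (subst (_≤ _) (sym k≡1+j) j<p) (p≢k ∘ sym)

  left-of-k : ∀ {i} → i Fin.< k → i ≢ j → i Fin.< j
  left-of-k i<k i≢j = Finₚ.≤∧≢⇒< (ℕₚ.≤-pred (subst (_ ≤_) k≡1+j i<k)) i≢j

  rowD-other : ∀ {i c} → i ≢ j → i ≢ k → InD v i c → InD w i c
  rowD-other {i} {c} i≢j i≢k ((p , v[p]≡c , i<p) , c<v[i]) =
    (transpose j k p , trans (sym (lookup-swap w j k p)) v[p]≡c , i<τp (p Fin.≟ j) (p Fin.≟ k)) ,
    subst (c Fin.<_) (lookup-swap-≢ w i≢j i≢k) c<v[i]
    where
    i<τp : Dec (p ≡ j) → Dec (p ≡ k) → i Fin.< transpose j k p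
    i<τp (yes refl) _        = subst (i Fin.<_) (sym (transpose-matchˡ p k)) (ℕₚ.<-trans i<p j<k)
    i<τp (no _) (yes refl)   = subst (i Fin.<_) (sym (transpose-matchʳ j p)) (left-of-k i<p i≢j)
    i<τp (no p≢j) (no p≢k)   = subst (i Fin.<_) (sym (transpose-other p≢j p≢k)) i<p

  rowD-j : ∀ {c} → InD v j c → InD w k c ⊎ c ≡ lookup w j
  rowD-j {c} ((p , v[p]≡c , j<p) , c<v[j]) with p Fin.≟ k
  ... | yes refl = inj₂ (trans (sym v[p]≡c) (lookup-swapʳ w j p))
  ... | no p≢k   = inj₁ ((p , trans (sym (lookup-swap-≢ w (Finₚ.<⇒≢ j<p ∘ sym) p≢k)) v[p]≡c , right-of-j j<p p≢k) ,
                         subst (c Fin.<_) (lookup-swapˡ w j k) c<v[j])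

  rowD-k : ∀ {c} → InD v k c → InD w k c
  rowD-k {c} ((p , v[p]≡c , k<p) , c<v[k]) =
    (p , trans (sym (lookup-swap-≢ w p≢j (Finₚ.<⇒≢ k<p ∘ sym))) v[p]≡c , k<p) ,
    ℕₚ.<-trans (subst (c Fin.<_) (lookup-swapʳ w j k) c<v[k]) ascent
    where
    p≢j : p ≢ j
    p≢j = Finₚ.<⇒≢ (ℕₚ.<-trans j<k k<p) ∘ sym

  closure-other : ∀ {i c} → i ≢ j → i ≢ k → InClosure v i c → InClosure w i c
  closure-other i≢j i≢k (i′ , i≤i′ , d) with i′ Fin.≟ j | i′ Fin.≟ k
  ... | no i′≢j | no i′≢k = i′ , i≤i′ , rowD-other i′≢j i′≢k d
  ... | no _    | yes refl = i′ , i≤i′ , rowD-k d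
  ... | yes refl | _ with rowD-j d
  ...   | inj₁ d′ = k , ℕₚ.≤-trans i≤i′ (ℕₚ.<⇒≤ j<k) , d′
  -- the cell (j, w(j)) of D(v) reappears one row up in D(w), because w(j−1) > w(j)
  ...   | inj₂ refl with pred-position (Finₚ.≤∧≢⇒< i≤i′ i≢j)
  ...     | h , j≡1+h , i≤h = h , i≤h , (i′ , refl , ℕₚ.≤-reflexive (sym j≡1+h)) , descent h j≡1+h

  closure-j : ∀ {c} → InClosure v j c → InClosure w k c ⊎ c ≡ lookup w j
  closure-j (i′ , j≤i′ , d) with i′ Fin.≟ j | i′ Fin.≟ k
  ... | yes refl | _       = Sum.map₁ (λ d′ → k , ℕₚ.≤-refl , d′) (rowD-j d)
  ... | no _     | yes refl = inj₁ (i′ , ℕₚ.≤-refl , rowD-k d)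
  ... | no i′≢j  | no i′≢k  =
    inj₁ (i′ , ℕₚ.<⇒≤ (right-of-j (Finₚ.≤∧≢⇒< j≤i′ (i′≢j ∘ sym)) i′≢k) , rowD-other i′≢j i′≢k d)

  closure-k : ∀ {c} → InClosure v k c → InClosure w k c
  closure-k (i′ , k≤i′ , d) with i′ Fin.≟ j | i′ Fin.≟ k
  ... | yes refl | _        = ⊥-elim (ℕₚ.<-irrefl refl (ℕₚ.<-≤-trans j<k k≤i′))
  ... | no _     | yes refl = i′ , k≤i′ , rowD-k d
  ... | no i′≢j  | no i′≢k  = i′ , k≤i′ , rowD-other i′≢j i′≢k d

  closureExp-other : ∀ {i} → i ≢ j → i ≢ k → lookup (closureExp v) i ≤ lookup (closureExp w) i
  closureExp-other i≢j i≢k = closureExp-mono v w _ _ (closure-other i≢j i≢k)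

  closureExp-j : lookup (closureExp v) j ≤ suc (lookup (closureExp w) k)
  closureExp-j = closureExp-mono-insert v w j k (lookup w j) closure-j

  closureExp-k : lookup (closureExp v) k ≤ lookup (closureExp w) k
  closureExp-k = closureExp-mono v w k k closure-k

<-∸-swap : ∀ {m n k} → m < n ∸ suc k → k < n ∸ suc m
<-∸-swap {m} {n} {k} m<n∸1+k = ℕₚ.m+n≤o⇒m≤o∸n (suc k) (begin
  suc k + suc m ≡⟨ ℕₚ.+-comm (suc k) (suc m) ⟩
  suc m + suc k ≤⟨ ℕₚ.m≤o∸n⇒m+n≤o (suc m) (ℕₚ.<⇒≤ 1+k<n) m<n∸1+k ⟩
  n             ∎)
  where
  open ℕₚ.≤-Reasoning
  1+k<n : suc k < n
  1+k<n = ℕₚ.m∸n≢0⇒n<m λ n∸1+k≡0 → ℕₚ.n≮0 (subst (m <_) n∸1+k≡0 m<n∸1+k)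

δ≤closureExp-w₀ : ∀ n i → lookup (δ n) i ≤ lookup (closureExp (w₀ n)) i
δ≤closureExp-w₀ n i = begin
  lookup (δ n) i                                         ≡⟨ Vecₚ.lookup∘tabulate _ i ⟩
  n ∸ suc (toℕ i)                                        ≤⟨ length-filter-tabulate-≥ (inClosure? (w₀ n) i) id _ (ℕₚ.m∸n≤m n (suc (toℕ i))) leftCell ⟩
  length (filter (inClosure? (w₀ n) i) (List.allFin n))  ≡⟨ lookup-closureExp (w₀ n) i ⟨
  lookup (closureExp (w₀ n)) i                           ∎
  where
  open ℕₚ.≤-Reasoning
  leftCell : ∀ c → toℕ c < n ∸ suc (toℕ i) → InClosure (w₀ n) i c
  leftCell c c<n∸1+i = i , ℕₚ.≤-refl ,
    (opposite c , trans (Vecₚ.lookup∘tabulate opposite (opposite c)) (Finₚ.opposite-involutive c) ,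
                  subst (toℕ i <_) (sym (Finₚ.opposite-prop c)) (<-∸-swap {n = n} c<n∸1+i)) ,
    subst (toℕ c <_) (sym (trans (cong toℕ (Vecₚ.lookup∘tabulate opposite i)) (Finₚ.opposite-prop i))) c<n∸1+i

module _ (G : Vec (Fin n) n → Poly n) (G-groth : IsGrothendieckFamily n G) where

  closureBound-w₀ : BoundedBy (closureExp (w₀ n)) (G (w₀ n))
  closureBound-w₀ α α∈G i = subst (λ β → lookup β i ≤ lookup (closureExp (w₀ n)) i)
    (mono-support (δ n) α (α∈G ∘ trans (proj₁ G-groth α))) (δ≤closureExp-w₀ n i)

  closureBound-step : ∀ w → IsPerm w → ∀ {j k} → AscentAt w j k → DescentBefore w j →
    BoundedBy (closureExp (swap w j k)) (G (swap w j k)) → BoundedBy (closureExp w) (G w)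
  closureBound-step w w-perm {j} {k} (k≡1+j , w[j]<w[k]) descent Gv≤ α α∈Gw i = row (i Fin.≟ j) (i Fin.≟ k)
    where
    open AscentSwap w j k k≡1+j w[j]<w[k] descent
    T : ℕ
    T = suc (lookup (closureExp w) k)
    α-bounds : (∀ i → i ≢ j → i ≢ k → lookup α i ≤ lookup (closureExp v) i) × lookup α j < T × lookup α k < T
    α-bounds = divided-difference-bound j≢k (G v) (G w) (closureExp v) T
      (proj₂ G-groth w w-perm j k k≡1+j w[j]<w[k]) Gv≤ closureExp-j (s≤s closureExp-k) α α∈Gw
    row : Dec (i ≡ j) → Dec (i ≡ k) → lookup α i ≤ lookup (closureExp w) i
    row (yes refl) _        = ℕₚ.≤-trans (ℕₚ.≤-pred (proj₁ (proj₂ α-bounds))) (closureExp-antitone w (ℕₚ.<⇒≤ j<k))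
    row (no _)     (yes refl) = ℕₚ.≤-pred (proj₂ (proj₂ α-bounds))
    row (no i≢j)   (no i≢k)   = ℕₚ.≤-trans (proj₁ α-bounds i i≢j i≢k) (closureExp-other i≢j i≢k)

theorem1p2 : ∀ (n : ℕ) (G : Vec (Fin n) n → Poly n) → IsGrothendieckFamily n G →
    ∀ (w : Vec (Fin n) n) → IsPerm w →
    ∀ (α : Vec ℕ n) → coeff (G w) α ≢ 0ℤ →
    ∀ (i : Fin n) → lookup α i ≤ lookup (closureExp w) i
theorem1p2 n G G-groth w w-perm = bound w (ℕᵢ.<-wellFounded (positionSum w)) w-perm
  where
  bound : ∀ w → Acc _<_ (positionSum w) → IsPerm w → BoundedBy (closureExp w) (G w)
  bound w (acc smaller) w-perm with ascent? w
  ... | no no-ascent = subst (λ v → BoundedBy (closureExp v) (G v)) (sym (noAscent⇒≡w₀ w w-perm no-ascent))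
                             (closureBound-w₀ G G-groth)
  ... | yes (_ , _ , ascent) with ascent-after-descent w w-perm ascent
  ...   | j , k , ascent′@(k≡1+j , w[j]<w[k]) , descent =
          closureBound-step G G-groth w w-perm ascent′ descent
            (bound (swap w j k) (smaller (positionSum-swap-ascent w j k k≡1+j w[j]<w[k])) (IsPerm-swap w w-perm j k))
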